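{- Let $\tau,\tau'$ be partitions. If $\tau\sim\tau'$ then $1(\tau+1)\sim1(\tau'+1)$, and more generally $12\cdots k(\tau+k)\sim 12\cdots k(\tau'+k)$ for every $k\ge1$. In particular, for every $m\ge2$ the patterns $12\cdots(m-1)m(m+1)$, $12\cdots(m-1)mm$, $12\cdots(m-1)(m-1)m$ and $12\cdots(m-1)m(m-1)$ are equivalent. Conversely, if $1(\tau+1)\sim1(\tau'+1)$ then $\tau\sim\tau'$.
   Context: Partitions of $[n]$ are identified with canonical sequences $\pi_1\cdots\pi_n$ ($\pi_i=j$ iff $i$ lies in the $j$-th block, blocks ordered by increasing minima). A partition contains a pattern $\sigma$ if it has a subsequence order-isomorphic to $\sigma$, and avoids it otherwise; $p(n;\sigma)$ is the number of partitions of $[n]$ avoiding $\sigma$. Two patterns $\sigma,\sigma'$ are equivalent, $\sigma\sim\sigma'$, if $p(n;\sigma)=p(n;\sigma')$ for all $n$. For a sequence $S$, $S+k$ is obtained by adding $k$ to every term; juxtaposition denotes concatenation. -}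

module Defs where

open import Data.Nat using (ℕ; zero; suc; _+_; _∸_; _⊔_; _<ᵇ_; _≤ᵇ_)
open import Data.Bool using (Bool; true; false; _∧_; not)
open import Data.Bool.Properties using () renaming (_≟_ to _≟ᵇ_)
open import Data.List using (List; []; _∷_; _++_; map; length; filter; concatMap; upTo)
open import Data.Bool.ListAction using (any)
open import Relation.Nullary.Decidable using (does)
open import Relation.Binary.PropositionalEquality using (_≡_)

_==_ : Bool → Bool → Bool
a == b = does (a ≟ᵇ b)

-- canonical (restricted growth) sequence: first letter 1, each letter ≤ 1 + max of earlier letters
-- (argument m = maximum of the letters read so far, 0 at the start)
rgsFrom : ℕ → List ℕ → Bool
rgsFrom m []       = true
rgsFrom m (x ∷ xs) = (1 ≤ᵇ x) ∧ (x ≤ᵇ suc m) ∧ rgsFrom (m ⊔ x) xs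

canonical : List ℕ → Bool
canonical = rgsFrom 0

sameOrder : ℕ → ℕ → ℕ → ℕ → Bool
sameOrder x y u v = ((x <ᵇ y) == (u <ᵇ v)) ∧ ((y <ᵇ x) == (v <ᵇ u))

zipAll : (ℕ → ℕ → Bool) → List ℕ → List ℕ → Bool
zipAll f []       []       = true
zipAll f (x ∷ xs) (y ∷ ys) = f x y ∧ zipAll f xs ys
zipAll f _        _        = false

orderIso : List ℕ → List ℕ → Bool
orderIso []       []       = true
orderIso (x ∷ xs) (u ∷ us) = zipAll (λ y v → sameOrder x y u v) xs us ∧ orderIso xs us
orderIso _        _        = false

subseqs : List ℕ → List (List ℕ)
subseqs []       = [] ∷ []
subseqs (x ∷ xs) = map (x ∷_) (subseqs xs) ++ subseqs xs

contains : List ℕ → List ℕ → Bool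
contains σ w = any (orderIso σ) (subseqs w)

avoids : List ℕ → List ℕ → Bool
avoids σ w = not (contains σ w)

words : ℕ → ℕ → List (List ℕ)
words k zero    = [] ∷ []
words k (suc n) = concatMap (λ x → map (x ∷_) (words k n)) (map suc (upTo k))

-- partitions of [n] (canonical sequences of length n; letters necessarily lie in 1..n)
partitionsOf : ℕ → List (List ℕ)
partitionsOf n = filter (λ w → canonical w ≟ᵇ true) (words n n)

p : ℕ → List ℕ → ℕ
p n σ = length (filter (λ w → avoids σ w ≟ᵇ true) (partitionsOf n))

_∼_ : List ℕ → List ℕ → Set
σ ∼ σ' = ∀ n → p n σ ≡ p n σ'

_+ˢ_ : List ℕ → ℕ → List ℕ
S +ˢ k = map (_+ k) S

inc : ℕ → List ℕ
inc k = map suc (upTo k)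

IsPartition : List ℕ → Set
IsPartition τ = canonical τ ≡ true

-- A partition of [n+1] is a canonical word 1w. Deleting the letters 1 from w and lowering the
-- others by one leaves a canonical word of some length j, and w is recovered from it together with
-- the set of j positions it occupied; moreover 1w avoids 1(τ+1) exactly when the shortened word
-- avoids τ. Hence p(n+1; 1(τ+1)) = Σⱼ C(n,j) p(j; τ): the counts of 1(τ+1) are the binomial
-- transform of those of τ, and this transform is invertible. Iterating gives the prefix 12⋯k.
-- For m ≥ 2 the four patterns are 12⋯(m−2) followed by ρ+(m−2) with ρ ∈ {123, 122, 112, 121},
-- and p(n+1; ρ) = 2ⁿ for each ρ: for 123 and 122 as binomial transforms of the constant counts of
-- 12 and 11, and for 121 and 112 because the ones of w must form a prefix, resp. a suffix, of w,
-- so that p(n+1; ρ) = Σ_{j≤n} p(j; ρ).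

module Submission where

open import Defs
open import Data.Nat using (ℕ; zero; suc; _+_; _*_; _^_; _∸_; _≤_; _<_; _⊔_; _<ᵇ_; _≤ᵇ_; z≤n; s≤s; pred)
open import Data.Nat.Properties
  using ( +-identityʳ; +-assoc; +-comm; +-suc; ⊔-identityʳ; +-cancelˡ-≡; *-zeroʳ; *-identityʳ
        ; ≤-refl; ≤-trans; ≤-antisym; <-trans; ≤-<-trans; <⇒≤; +-monoˡ-≤; ⊔-lub; n≤1+n; m≤m+n
        ; <ᵇ⇒<; <⇒<ᵇ; ≤ᵇ⇒≤)
open import Data.Nat.ListAction using (sum)
open import Data.Nat.Tactic.RingSolver using (solve-∀)
open import Data.Bool using (Bool; true; false; _∧_; not; if_then_else_)
open import Data.Bool.Properties using (T-≡; ∧-conicalˡ; ∧-conicalʳ; ∧-zeroʳ) renaming (_≟_ to _≟ᵇ_)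
open import Data.Bool.ListAction using (and; all)
open import Data.List using (List; []; _∷_; _++_; map; length; filter; concatMap; concat; upTo; applyUpTo)
open import Data.List.Properties using (map-applyUpTo; map-++; ++-assoc; ++-identityʳ; applyUpTo-∷ʳ; map-∘; map-cong; map-id)
open import Data.List.Relation.Unary.All using (All; []; _∷_)
import Data.List.Relation.Unary.All as All
import Data.List.Relation.Unary.All.Properties as All
open import Data.List.Relation.Unary.Any using (Any; here)
open import Data.List.Relation.Unary.Any.Properties using (any⁺; any⁻; ++⁺ˡ; ++⁺ʳ; ++⁻; map⁺; map⁻)
open import Data.List.Relation.Binary.Sublist.Propositional using (_⊆_; []; _∷ʳ_; _∷_; minimum)
open import Data.List.Relation.Binary.Sublist.Propositional.Properties using (All-resp-⊆; ∷⁻)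
open import Data.Product using (_×_; _,_; ∃-syntax)
open import Data.Sum using (_⊎_; inj₁; inj₂)
open import Function using (_∘_; id; Equivalence)
open import Relation.Unary using (Pred)
open import Relation.Binary.PropositionalEquality
  using (_≡_; refl; sym; trans; cong; cong₂; subst; subst₂; module ≡-Reasoning)

-- Restricted growth words

indicator : Bool → ℕ
indicator true  = 1
indicator false = 0

countᵇ : (List ℕ → Bool) → List (List ℕ) → ℕ
countᵇ f []       = 0
countᵇ f (w ∷ ws) = indicator (f w) + countᵇ f ws

length-filter : ∀ (f : List ℕ → Bool) ws → length (filter (λ w → f w ≟ᵇ true) ws) ≡ countᵇ f ws
length-filter f []       = refl
length-filter f (w ∷ ws) with f w
... | true  = cong suc (length-filter f ws)
... | false = length-filter f ws

countᵇ-filter : ∀ (f g : List ℕ → Bool) ws → countᵇ g (filter (λ w → f w ≟ᵇ true) ws) ≡ countᵇ (λ w → f w ∧ g w) ws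
countᵇ-filter f g []       = refl
countᵇ-filter f g (w ∷ ws) with f w
... | true  = cong (indicator (g w) +_) (countᵇ-filter f g ws)
... | false = countᵇ-filter f g ws

countᵇ-cong : ∀ {f g} ws → (∀ w → f w ≡ g w) → countᵇ f ws ≡ countᵇ g ws
countᵇ-cong []       f≗g = refl
countᵇ-cong (w ∷ ws) f≗g = cong₂ _+_ (cong indicator (f≗g w)) (countᵇ-cong ws f≗g)

countᵇ-false : ∀ {f} ws → (∀ w → f w ≡ false) → countᵇ f ws ≡ 0
countᵇ-false []       f≡false = refl
countᵇ-false (w ∷ ws) f≡false rewrite f≡false w = countᵇ-false ws f≡false

countᵇ-++ : ∀ (f : List ℕ → Bool) vs ws → countᵇ f (vs ++ ws) ≡ countᵇ f vs + countᵇ f ws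
countᵇ-++ f []       ws = refl
countᵇ-++ f (v ∷ vs) ws rewrite countᵇ-++ f vs ws = sym (+-assoc (indicator (f v)) _ _)

countᵇ-map : ∀ (f : List ℕ → Bool) (g : List ℕ → List ℕ) ws → countᵇ f (map g ws) ≡ countᵇ (f ∘ g) ws
countᵇ-map f g []       = refl
countᵇ-map f g (w ∷ ws) = cong (indicator (f (g w)) +_) (countᵇ-map f g ws)

countᵇ-concatMap : ∀ (f : List ℕ → Bool) (g : ℕ → List (List ℕ)) xs →
                   countᵇ f (concatMap g xs) ≡ sum (map (countᵇ f ∘ g) xs)
countᵇ-concatMap f g []       = refl
countᵇ-concatMap f g (x ∷ xs) =
  trans (countᵇ-++ f (g x) (concat (map g xs))) (cong (countᵇ f (g x) +_) (countᵇ-concatMap f g xs))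

∑< : ℕ → (ℕ → ℕ) → ℕ
∑< zero    f = 0
∑< (suc k) f = f 0 + ∑< k (f ∘ suc)

sum-map-applyUpTo : ∀ (g h : ℕ → ℕ) k → sum (map g (applyUpTo h k)) ≡ ∑< k (g ∘ h)
sum-map-applyUpTo g h zero    = refl
sum-map-applyUpTo g h (suc k) = cong (g (h 0) +_) (sum-map-applyUpTo g (h ∘ suc) k)

∑<-cong : ∀ k {f g} → (∀ i → f i ≡ g i) → ∑< k f ≡ ∑< k g
∑<-cong zero    f≗g = refl
∑<-cong (suc k) f≗g = cong₂ _+_ (f≗g 0) (∑<-cong k (f≗g ∘ suc))

∑<-zeros : ∀ k {f} → (∀ i → f i ≡ 0) → ∑< k f ≡ 0
∑<-zeros zero    f≗0 = refl
∑<-zeros (suc k) f≗0 rewrite f≗0 0 = ∑<-zeros k (f≗0 ∘ suc)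

∑<-distrib-+ : ∀ k (f g : ℕ → ℕ) → ∑< k (λ i → f i + g i) ≡ ∑< k f + ∑< k g
∑<-distrib-+ zero    f g = refl
∑<-distrib-+ (suc k) f g rewrite ∑<-distrib-+ k (f ∘ suc) (g ∘ suc) =
  interchange (f 0) (g 0) (∑< k (f ∘ suc)) (∑< k (g ∘ suc))
  where
  interchange : ∀ a b c d → (a + b) + (c + d) ≡ (a + c) + (b + d)
  interchange = solve-∀

∑<-truncate : ∀ a k {f g} → a ≤ k → (∀ i → i < a → g i ≡ f i) → (∀ i → a ≤ i → g i ≡ 0) →
              ∑< k g ≡ ∑< a f
∑<-truncate zero    k       a≤k below above = ∑<-zeros k (λ i → above i z≤n)
∑<-truncate (suc a) (suc k) (s≤s a≤k) below above =
  cong₂ _+_ (below 0 (s≤s z≤n)) (∑<-truncate a k a≤k (λ i → below (suc i) ∘ s≤s) (λ i → above (suc i) ∘ s≤s))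

∑<-snoc : ∀ k f → ∑< (suc k) f ≡ ∑< k f + f k
∑<-snoc zero    f = +-identityʳ (f 0)
∑<-snoc (suc k) f = trans (cong (f 0 +_) (∑<-snoc k (f ∘ suc))) (sym (+-assoc (f 0) _ _))

<ᵇ-true : ∀ {m n} → m < n → (m <ᵇ n) ≡ true
<ᵇ-true = Equivalence.to T-≡ ∘ <⇒<ᵇ

<ᵇ-false : ∀ {m n} → n ≤ m → (m <ᵇ n) ≡ false
<ᵇ-false {m}     {zero}  _         = refl
<ᵇ-false {suc m} {suc n} (s≤s n≤m) = <ᵇ-false n≤m

<ᵇ-false⇒≥ : ∀ m n → (m <ᵇ n) ≡ false → n ≤ m
<ᵇ-false⇒≥ m       zero    _  = z≤n
<ᵇ-false⇒≥ (suc m) (suc n) eq = s≤s (<ᵇ-false⇒≥ m n eq)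

rgsCount : ℕ → ℕ → (List ℕ → Bool) → ℕ
rgsCount m zero    P = indicator (P [])
rgsCount m (suc n) P = ∑< (suc m) (λ i → rgsCount (m ⊔ suc i) n (λ w → P (suc i ∷ w)))

countᵇ-words : ∀ n m k P → m + n ≤ k → countᵇ (λ w → rgsFrom m w ∧ P w) (words k n) ≡ rgsCount m n P
countᵇ-words zero    m k P _     = +-identityʳ (indicator (P []))
countᵇ-words (suc n) m k P m+n≤k = begin
  countᵇ F (concatMap (λ x → map (x ∷_) (words k n)) (map suc (upTo k)))
    ≡⟨ countᵇ-concatMap F _ (map suc (upTo k)) ⟩
  sum (map G (map suc (upTo k)))
    ≡⟨ cong (sum ∘ map G) (map-applyUpTo id suc k) ⟩
  sum (map G (applyUpTo suc k))
    ≡⟨ sum-map-applyUpTo G suc k ⟩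
  ∑< k (G ∘ suc)
    ≡⟨ ∑<-truncate (suc m) k (≤-trans (m≤m+n (suc m) n) 1+m+n≤k) allowed forbidden ⟩
  rgsCount m (suc n) P ∎
  where
  open ≡-Reasoning
  F : List ℕ → Bool
  F w = rgsFrom m w ∧ P w
  G : ℕ → ℕ
  G x = countᵇ F (map (x ∷_) (words k n))
  1+m+n≤k : suc m + n ≤ k
  1+m+n≤k = subst (_≤ k) (+-suc m n) m+n≤k
  allowed : ∀ i → i < suc m → G (suc i) ≡ rgsCount (m ⊔ suc i) n (λ w → P (suc i ∷ w))
  allowed i i≤m = begin
    G (suc i)
      ≡⟨ countᵇ-map F (suc i ∷_) (words k n) ⟩
    countᵇ (F ∘ (suc i ∷_)) (words k n)
      ≡⟨ countᵇ-cong (words k n) (λ w → cong (λ b → (b ∧ rgsFrom (m ⊔ suc i) w) ∧ P (suc i ∷ w)) (<ᵇ-true i≤m)) ⟩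
    countᵇ (λ w → rgsFrom (m ⊔ suc i) w ∧ P (suc i ∷ w)) (words k n)
      ≡⟨ countᵇ-words n (m ⊔ suc i) k _ (≤-trans (+-monoˡ-≤ n (⊔-lub (n≤1+n m) i≤m)) 1+m+n≤k) ⟩
    rgsCount (m ⊔ suc i) n (λ w → P (suc i ∷ w)) ∎
  forbidden : ∀ i → suc m ≤ i → G (suc i) ≡ 0
  forbidden i m<i = trans (countᵇ-map F (suc i ∷_) (words k n))
    (countᵇ-false (words k n) (λ w → cong (λ b → (b ∧ rgsFrom (m ⊔ suc i) w) ∧ P (suc i ∷ w)) (<ᵇ-false m<i)))

p≡rgsCount : ∀ n σ → p n σ ≡ rgsCount 0 n (avoids σ)
p≡rgsCount n σ = begin
  p n σ                                                   ≡⟨ length-filter (avoids σ) (partitionsOf n) ⟩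
  countᵇ (avoids σ) (partitionsOf n)                      ≡⟨ countᵇ-filter canonical (avoids σ) (words n n) ⟩
  countᵇ (λ w → canonical w ∧ avoids σ w) (words n n)     ≡⟨ countᵇ-words n 0 n (avoids σ) ≤-refl ⟩
  rgsCount 0 n (avoids σ)                                 ∎
  where open ≡-Reasoning

-- Deleting the first block

removeOnes : List ℕ → List ℕ
removeOnes []                = []
removeOnes (suc (suc x) ∷ w) = suc x ∷ removeOnes w
removeOnes (_ ∷ w)           = removeOnes w

highMask : List ℕ → List Bool
highMask []                = []
highMask (suc (suc x) ∷ w) = true ∷ highMask w
highMask (_ ∷ w)           = false ∷ highMask w

-- maskSum n R X is the sum of X (number of trues in bs) over all bs : Bool ^ n with R bs.
maskSum : ℕ → (List Bool → Bool) → (ℕ → ℕ) → ℕ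
maskSum zero    R X = if R [] then X 0 else 0
maskSum (suc n) R X = maskSum n (R ∘ (false ∷_)) X + maskSum n (R ∘ (true ∷_)) (X ∘ suc)

binomial : ℕ → (ℕ → ℕ) → ℕ
binomial n = maskSum n (λ _ → true)

maskSum-cong : ∀ n R {X Y} → (∀ j → X j ≡ Y j) → maskSum n R X ≡ maskSum n R Y
maskSum-cong zero    R X≗Y with R []
... | true  = X≗Y 0
... | false = refl
maskSum-cong (suc n) R X≗Y = cong₂ _+_ (maskSum-cong n _ X≗Y) (maskSum-cong n _ (X≗Y ∘ suc))

maskSum-none : ∀ n X → maskSum n (λ _ → false) X ≡ 0
maskSum-none zero    X = refl
maskSum-none (suc n) X = cong₂ _+_ (maskSum-none n X) (maskSum-none n _)

∑<-maskSum : ∀ n k R (F : ℕ → ℕ → ℕ) → ∑< k (λ i → maskSum n R (F i)) ≡ maskSum n R (λ j → ∑< k (λ i → F i j))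
∑<-maskSum zero    k R F with R []
... | true  = refl
... | false = ∑<-zeros k (λ _ → refl)
∑<-maskSum (suc n) k R F =
  trans (∑<-distrib-+ k (λ i → maskSum n (R ∘ (false ∷_)) (F i)) (λ i → maskSum n (R ∘ (true ∷_)) (F i ∘ suc)))
        (cong₂ _+_ (∑<-maskSum n k _ F) (∑<-maskSum n k _ (λ i → F i ∘ suc)))

-- By definition binomial (suc n) X ≡ binomial n X + binomial n (X ∘ suc) (Pascal's rule).
binomial-injective : ∀ {X Y} → (∀ n → binomial n X ≡ binomial n Y) → ∀ j → X j ≡ Y j
binomial-injective eq zero    = eq 0
binomial-injective {X} {Y} eq (suc j) = binomial-injective shifted j
  where
  shifted : ∀ n → binomial n (X ∘ suc) ≡ binomial n (Y ∘ suc)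
  shifted n = +-cancelˡ-≡ (binomial n X) _ _
    (trans (eq (suc n)) (cong (_+ binomial n (Y ∘ suc)) (sym (eq n))))

binomial-const : ∀ n {X} c → (∀ j → X j ≡ c) → binomial n X ≡ 2 ^ n * c
binomial-const n {X} c X≗c = trans (maskSum-cong n _ X≗c) (binomial-constant n)
  where
  binomial-constant : ∀ n → binomial n (λ _ → c) ≡ 2 ^ n * c
  binomial-constant zero    = sym (+-identityʳ c)
  binomial-constant (suc n) rewrite binomial-constant n = double (2 ^ n) c
    where
    double : ∀ a b → a * b + a * b ≡ (2 * a) * b
    double = solve-∀

rgsCount-split : ∀ n m Q R →
  rgsCount (suc m) n (λ w → Q (removeOnes w) ∧ R (highMask w)) ≡ maskSum n R (λ j → rgsCount m j Q)
rgsCount-split zero    m Q R with R [] | Q []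
... | true  | true  = refl
... | true  | false = refl
... | false | true  = refl
... | false | false = refl
rgsCount-split (suc n) m Q R = cong₂ _+_ lowLetter highLetters
  where
  lowLetter : rgsCount (suc (m ⊔ 0)) n (λ w → Q (removeOnes w) ∧ R (false ∷ highMask w))
            ≡ maskSum n (R ∘ (false ∷_)) (λ j → rgsCount m j Q)
  lowLetter rewrite ⊔-identityʳ m = rgsCount-split n m Q (R ∘ (false ∷_))
  highLetters : ∑< (suc m) (λ i → rgsCount (suc (m ⊔ suc i)) n (λ w → Q (suc i ∷ removeOnes w) ∧ R (true ∷ highMask w)))
              ≡ maskSum n (R ∘ (true ∷_)) (λ j → rgsCount m (suc j) Q)
  highLetters = trans
    (∑<-cong (suc m) (λ i → rgsCount-split n (m ⊔ suc i) (λ u → Q (suc i ∷ u)) (R ∘ (true ∷_))))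
    (∑<-maskSum n (suc m) (R ∘ (true ∷_)) (λ i j → rgsCount (m ⊔ suc i) j (λ u → Q (suc i ∷ u))))

-- Subsequences and order isomorphism

Any-subseqs⁻ : ∀ {ℓ} {P : Pred (List ℕ) ℓ} w → Any P (subseqs w) → ∃[ t ] t ⊆ w × P t
Any-subseqs⁻ []      (here pt) = [] , [] , pt
Any-subseqs⁻ (x ∷ w) any-w with ++⁻ (map (x ∷_) (subseqs w)) any-w
... | inj₁ withX with Any-subseqs⁻ w (map⁻ withX)
...   | t , t⊆w , pt = x ∷ t , refl ∷ t⊆w , pt
Any-subseqs⁻ (x ∷ w) any-w | inj₂ withoutX with Any-subseqs⁻ w withoutX
...   | t , t⊆w , pt = t , x ∷ʳ t⊆w , pt

Any-subseqs⁺ : ∀ {ℓ} {P : Pred (List ℕ) ℓ} {t w} → t ⊆ w → P t → Any P (subseqs w)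
Any-subseqs⁺ []                 pt = here pt
Any-subseqs⁺ (_∷ʳ_ {ys = w} x s) pt = ++⁺ʳ (map (x ∷_) (subseqs w)) (Any-subseqs⁺ s pt)
Any-subseqs⁺ (refl ∷ s)         pt = ++⁺ˡ (map⁺ (Any-subseqs⁺ s pt))

contains⇒⊆ : ∀ σ w → contains σ w ≡ true → ∃[ t ] t ⊆ w × orderIso σ t ≡ true
contains⇒⊆ σ w σ∈w with Any-subseqs⁻ w (any⁻ (orderIso σ) (subseqs w) (Equivalence.from T-≡ σ∈w))
... | t , t⊆w , iso = t , t⊆w , Equivalence.to T-≡ iso

⊆⇒contains : ∀ σ {t w} → t ⊆ w → orderIso σ t ≡ true → contains σ w ≡ true
⊆⇒contains σ t⊆w iso = Equivalence.to T-≡ (any⁺ (orderIso σ) (Any-subseqs⁺ t⊆w (Equivalence.from T-≡ iso)))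

<ᵇ-+1 : ∀ u v → (u + 1 <ᵇ v + 1) ≡ (u <ᵇ v)
<ᵇ-+1 u v rewrite +-comm u 1 | +-comm v 1 = refl

sameOrder-+1ˡ : ∀ x y u v → sameOrder (x + 1) (y + 1) u v ≡ sameOrder x y u v
sameOrder-+1ˡ x y u v rewrite <ᵇ-+1 x y | <ᵇ-+1 y x = refl

sameOrder-+1ʳ : ∀ x y u v → sameOrder x y (u + 1) (v + 1) ≡ sameOrder x y u v
sameOrder-+1ʳ x y u v rewrite <ᵇ-+1 u v | <ᵇ-+1 v u = refl

zipAll-+1ˡ : ∀ x u ys vs →
  zipAll (λ y v → sameOrder (x + 1) y u v) (ys +ˢ 1) vs ≡ zipAll (λ y v → sameOrder x y u v) ys vs
zipAll-+1ˡ x u []       []       = refl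
zipAll-+1ˡ x u []       (v ∷ vs) = refl
zipAll-+1ˡ x u (y ∷ ys) []       = refl
zipAll-+1ˡ x u (y ∷ ys) (v ∷ vs) = cong₂ _∧_ (sameOrder-+1ˡ x y u v) (zipAll-+1ˡ x u ys vs)

zipAll-+1ʳ : ∀ x u ys vs →
  zipAll (λ y v → sameOrder x y (u + 1) v) ys (vs +ˢ 1) ≡ zipAll (λ y v → sameOrder x y u v) ys vs
zipAll-+1ʳ x u []       []       = refl
zipAll-+1ʳ x u []       (v ∷ vs) = refl
zipAll-+1ʳ x u (y ∷ ys) []       = refl
zipAll-+1ʳ x u (y ∷ ys) (v ∷ vs) = cong₂ _∧_ (sameOrder-+1ʳ x y u v) (zipAll-+1ʳ x u ys vs)

orderIso-+1ˡ : ∀ σ t → orderIso (σ +ˢ 1) t ≡ orderIso σ t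
orderIso-+1ˡ []      []      = refl
orderIso-+1ˡ []      (u ∷ t) = refl
orderIso-+1ˡ (x ∷ σ) []      = refl
orderIso-+1ˡ (x ∷ σ) (u ∷ t) = cong₂ _∧_ (zipAll-+1ˡ x u σ t) (orderIso-+1ˡ σ t)

orderIso-+1ʳ : ∀ σ t → orderIso σ (t +ˢ 1) ≡ orderIso σ t
orderIso-+1ʳ []      []      = refl
orderIso-+1ʳ []      (u ∷ t) = refl
orderIso-+1ʳ (x ∷ σ) []      = refl
orderIso-+1ʳ (x ∷ σ) (u ∷ t) = cong₂ _∧_ (zipAll-+1ʳ x u σ t) (orderIso-+1ʳ σ t)

orderIso-length : ∀ σ t → orderIso σ t ≡ true → length σ ≡ length t
orderIso-length []      []      _   = refl
orderIso-length (x ∷ σ) (u ∷ t) iso = cong suc (orderIso-length σ t (∧-conicalʳ _ _ iso))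

==⇒≡ : ∀ a b → a == b ≡ true → a ≡ b
==⇒≡ true  true  _ = refl
==⇒≡ false false _ = refl

sameOrder-< : ∀ {x y u v} → sameOrder x y u v ≡ true → x < y → u < v
sameOrder-< {u = u} {v} same x<y =
  <ᵇ⇒< u v (Equivalence.from T-≡ (trans (sym (==⇒≡ _ _ (∧-conicalˡ _ _ same))) (<ᵇ-true x<y)))

sameOrder-≡ : ∀ {x u v} → sameOrder x x u v ≡ true → u ≡ v
sameOrder-≡ {x} {u} {v} same = ≤-antisym (≮⇒≥ v u (∧-conicalʳ _ _ same)) (≮⇒≥ u v (∧-conicalˡ _ _ same))
  where
  ≮⇒≥ : ∀ a b → ((x <ᵇ x) == (a <ᵇ b)) ≡ true → b ≤ a
  ≮⇒≥ a b eq = <ᵇ-false⇒≥ a b (trans (sym (==⇒≡ _ _ eq)) (<ᵇ-false (≤-refl {x})))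

sameOrder-<< : ∀ {x y u v} → x < y → u < v → sameOrder x y u v ≡ true
sameOrder-<< x<y u<v rewrite <ᵇ-true x<y | <ᵇ-true u<v | <ᵇ-false (<⇒≤ x<y) | <ᵇ-false (<⇒≤ u<v) = refl

orderIso-∷⁻ : ∀ {x u} σ t → orderIso (x ∷ σ) (u ∷ t) ≡ true → All (x <_) σ → All (u <_) t
orderIso-∷⁻ σ t iso = heads σ t (∧-conicalˡ _ _ iso)
  where
  heads : ∀ {x u} σ t → zipAll (λ y v → sameOrder x y u v) σ t ≡ true → All (x <_) σ → All (u <_) t
  heads []      []      _    []          = []
  heads (y ∷ σ) (v ∷ t) same (x<y ∷ σ>x) = sameOrder-< (∧-conicalˡ _ _ same) x<y ∷ heads σ t (∧-conicalʳ _ _ same) σ>x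

orderIso-∷⁺ : ∀ {x u σ t} → All (x <_) σ → All (u <_) t → orderIso σ t ≡ true → orderIso (x ∷ σ) (u ∷ t) ≡ true
orderIso-∷⁺ {σ = σ} {t} σ>x t>u iso = cong₂ _∧_ (heads σ>x t>u (orderIso-length σ t iso)) iso
  where
  heads : ∀ {x u σ t} → All (x <_) σ → All (u <_) t → length σ ≡ length t →
          zipAll (λ y v → sameOrder x y u v) σ t ≡ true
  heads []            []            _   = refl
  heads (x<y ∷ σ>x)   (u<v ∷ t>u)   len = cong₂ _∧_ (sameOrder-<< x<y u<v) (heads σ>x t>u (cong pred len))

Positive : List ℕ → Set
Positive = All (1 ≤_)

rgsFrom-positive : ∀ m w → rgsFrom m w ≡ true → Positive w
rgsFrom-positive m []      _   = []
rgsFrom-positive m (x ∷ w) rgs =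
  ≤ᵇ⇒≤ 1 x (Equivalence.from T-≡ (∧-conicalˡ _ _ rgs))
  ∷ rgsFrom-positive (m ⊔ x) w (∧-conicalʳ (x ≤ᵇ suc m) _ (∧-conicalʳ (1 ≤ᵇ x) _ rgs))

+1-positive : ∀ {t} → Positive t → All (1 <_) (t +ˢ 1)
+1-positive = All.map⁺ ∘ All.map (+-monoˡ-≤ 1)

removeOnes-positive : ∀ w → Positive (removeOnes w)
removeOnes-positive []                = []
removeOnes-positive (zero ∷ w)        = removeOnes-positive w
removeOnes-positive (suc zero ∷ w)    = removeOnes-positive w
removeOnes-positive (suc (suc x) ∷ w) = s≤s z≤n ∷ removeOnes-positive w

removeOnes-mono : ∀ {t w} → t ⊆ w → removeOnes t ⊆ removeOnes w
removeOnes-mono []                             = []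
removeOnes-mono (zero ∷ʳ s)                    = removeOnes-mono s
removeOnes-mono (suc zero ∷ʳ s)                = removeOnes-mono s
removeOnes-mono (suc (suc x) ∷ʳ s)             = suc x ∷ʳ removeOnes-mono s
removeOnes-mono (_∷_ {x = zero} refl s)        = removeOnes-mono s
removeOnes-mono (_∷_ {x = suc zero} refl s)    = removeOnes-mono s
removeOnes-mono (_∷_ {x = suc (suc x)} refl s) = refl ∷ removeOnes-mono s

removeOnes-+1 : ∀ {t} → All (1 <_) t → removeOnes t +ˢ 1 ≡ t
removeOnes-+1 []                                  = refl
removeOnes-+1 {suc (suc x) ∷ t} (s≤s (s≤s _) ∷ t>1) = cong₂ _∷_ (+-comm (suc x) 1) (removeOnes-+1 t>1)

⊆-removeOnes⁻ : ∀ {t} w → t ⊆ removeOnes w → t +ˢ 1 ⊆ w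
⊆-removeOnes⁻ []                []           = []
⊆-removeOnes⁻ (zero ∷ w)        s            = zero ∷ʳ ⊆-removeOnes⁻ w s
⊆-removeOnes⁻ (suc zero ∷ w)    s            = suc zero ∷ʳ ⊆-removeOnes⁻ w s
⊆-removeOnes⁻ (suc (suc x) ∷ w) (_ ∷ʳ s)     = suc (suc x) ∷ʳ ⊆-removeOnes⁻ w s
⊆-removeOnes⁻ (suc (suc x) ∷ w) (refl ∷ s)   = +-comm (suc x) 1 ∷ ⊆-removeOnes⁻ w s

removeOnes-contains⁺ : ∀ σ {t w} → t ⊆ w → All (1 <_) t → orderIso σ t ≡ true → contains σ (removeOnes w) ≡ true
removeOnes-contains⁺ σ {t} t⊆w t>1 iso = ⊆⇒contains σ (removeOnes-mono t⊆w) (begin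
  orderIso σ (removeOnes t)          ≡⟨ orderIso-+1ʳ σ (removeOnes t) ⟨
  orderIso σ (removeOnes t +ˢ 1)     ≡⟨ cong (orderIso σ) (removeOnes-+1 t>1) ⟩
  orderIso σ t                       ≡⟨ iso ⟩
  true                               ∎)
  where open ≡-Reasoning

removeOnes-contains⁻ : ∀ σ w → contains σ (removeOnes w) ≡ true →
                       ∃[ t ] t ⊆ w × All (1 <_) t × orderIso σ t ≡ true
removeOnes-contains⁻ σ w σ∈w with contains⇒⊆ σ (removeOnes w) σ∈w
... | t , t⊆w , iso = t +ˢ 1 , ⊆-removeOnes⁻ w t⊆w
                    , +1-positive (All-resp-⊆ t⊆w (removeOnes-positive w))
                    , trans (orderIso-+1ʳ σ t) iso

not≡not∧ : ∀ {c c' r} → (c ≡ true → c' ≡ true ⊎ r ≡ false) → (c' ≡ true → c ≡ true) → (r ≡ false → c ≡ true) →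
           not c ≡ not c' ∧ r
not≡not∧ {false} {false} {true}  _ _  _  = refl
not≡not∧ {false} {false} {false} _ _  ⇐r with ⇐r refl
... | ()
not≡not∧ {false} {true}          _ ⇐c' _ with ⇐c' refl
... | ()
not≡not∧ {true}  {true}          _ _  _  = refl
not≡not∧ {true}  {false} {false} _ _  _  = refl
not≡not∧ {true}  {false} {true}  ⇒ _  _  with ⇒ refl
... | inj₁ ()
... | inj₂ ()

rgsCount-cong : ∀ m n {P Q} → (∀ w → Positive w → P w ≡ Q w) → rgsCount m n P ≡ rgsCount m n Q
rgsCount-cong m zero    P≗Q = cong indicator (P≗Q [] [])
rgsCount-cong m (suc n) P≗Q = ∑<-cong (suc m) (λ i → rgsCount-cong (m ⊔ suc i) n (λ w pw → P≗Q (suc i ∷ w) (s≤s z≤n ∷ pw)))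

p-suc : ∀ n σ σ' R → (∀ w → Positive w → avoids σ (1 ∷ w) ≡ avoids σ' (removeOnes w) ∧ R (highMask w)) →
        p (suc n) σ ≡ maskSum n R (λ j → p j σ')
p-suc n σ σ' R split = begin
  p (suc n) σ                                                        ≡⟨ p≡rgsCount (suc n) σ ⟩
  rgsCount 1 n (avoids σ ∘ (1 ∷_)) + 0                               ≡⟨ +-identityʳ _ ⟩
  rgsCount 1 n (avoids σ ∘ (1 ∷_))                                   ≡⟨ rgsCount-cong 1 n split ⟩
  rgsCount 1 n (λ w → avoids σ' (removeOnes w) ∧ R (highMask w))     ≡⟨ rgsCount-split n 0 (avoids σ') R ⟩
  maskSum n R (λ j → rgsCount 0 j (avoids σ'))                       ≡⟨ maskSum-cong n R (λ j → sym (p≡rgsCount j σ')) ⟩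
  maskSum n R (λ j → p j σ')                                         ∎
  where open ≡-Reasoning

lift-contains⇒ : ∀ τ w → Positive τ → Positive w →
                 contains (1 ∷ (τ +ˢ 1)) (1 ∷ w) ≡ true → contains τ (removeOnes w) ≡ true
lift-contains⇒ τ w pτ pw τ∈w with contains⇒⊆ _ (1 ∷ w) τ∈w
... | a ∷ t , at⊆1w , iso with All-resp-⊆ at⊆1w (s≤s z≤n ∷ pw)
...   | 1≤a ∷ _ = removeOnes-contains⁺ τ (∷⁻ at⊆1w)
          (All.map (≤-<-trans 1≤a) (orderIso-∷⁻ (τ +ˢ 1) t iso (+1-positive pτ)))
          (trans (sym (orderIso-+1ˡ τ t)) (∧-conicalʳ _ _ iso))

lift-contains⇐ : ∀ τ w → Positive τ → contains τ (removeOnes w) ≡ true → contains (1 ∷ (τ +ˢ 1)) (1 ∷ w) ≡ true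
lift-contains⇐ τ w pτ τ∈w with removeOnes-contains⁻ τ w τ∈w
... | t , t⊆w , t>1 , iso =
  ⊆⇒contains (1 ∷ (τ +ˢ 1)) (refl ∷ t⊆w) (orderIso-∷⁺ (+1-positive pτ) t>1 (trans (orderIso-+1ˡ τ t) iso))

p-suc-lift : ∀ n τ → Positive τ → p (suc n) (1 ∷ (τ +ˢ 1)) ≡ binomial n (λ j → p j τ)
p-suc-lift n τ pτ = p-suc n (1 ∷ (τ +ˢ 1)) τ (λ _ → true) λ w pw →
  not≡not∧ (inj₁ ∘ lift-contains⇒ τ w pτ pw) (lift-contains⇐ τ w pτ) λ ()

-- The patterns 11, 121 and 112

highMask-∷ : ∀ x w → highMask (x ∷ w) ≡ (1 <ᵇ x) ∷ highMask w
highMask-∷ zero          w = refl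
highMask-∷ (suc zero)    w = refl
highMask-∷ (suc (suc x)) w = refl

falsesThenTrues : List Bool → Bool
falsesThenTrues []           = true
falsesThenTrues (false ∷ bs) = falsesThenTrues bs
falsesThenTrues (true ∷ bs)  = and bs

truesThenFalses : List Bool → Bool
truesThenFalses []           = true
truesThenFalses (true ∷ bs)  = truesThenFalses bs
truesThenFalses (false ∷ bs) = all not bs

1⊆⇒¬and : ∀ {w} → (1 ∷ []) ⊆ w → and (highMask w) ≡ false
1⊆⇒¬and {x ∷ w} (_ ∷ʳ s) rewrite highMask-∷ x w | 1⊆⇒¬and s = ∧-zeroʳ (1 <ᵇ x)
1⊆⇒¬and         (refl ∷ s) = refl

¬and⇒1⊆ : ∀ {w} → Positive w → and (highMask w) ≡ false → (1 ∷ []) ⊆ w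
¬and⇒1⊆ {suc zero ∷ w}    (_ ∷ pw) _      = refl ∷ minimum w
¬and⇒1⊆ {suc (suc x) ∷ w} (_ ∷ pw) ¬and = _ ∷ʳ ¬and⇒1⊆ pw ¬and

high⊆⇒¬allNot : ∀ {b w} → 1 < b → (b ∷ []) ⊆ w → all not (highMask w) ≡ false
high⊆⇒¬allNot {w = x ∷ w} 1<b (_ ∷ʳ s) rewrite highMask-∷ x w | high⊆⇒¬allNot 1<b s = ∧-zeroʳ (not (1 <ᵇ x))
high⊆⇒¬allNot {w = x ∷ w} 1<b (refl ∷ s) rewrite highMask-∷ x w | <ᵇ-true 1<b = refl

¬allNot⇒high⊆ : ∀ {w} → Positive w → all not (highMask w) ≡ false → ∃[ b ] 1 < b × (b ∷ []) ⊆ w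
¬allNot⇒high⊆ {suc zero ∷ w} (_ ∷ pw) ¬allNot with ¬allNot⇒high⊆ pw ¬allNot
... | b , 1<b , s = b , 1<b , _ ∷ʳ s
¬allNot⇒high⊆ {suc (suc x) ∷ w} _ _ = suc (suc x) , s≤s (s≤s z≤n) , refl ∷ minimum w

high1⊆⇒¬falsesThenTrues : ∀ {b w} → 1 < b → (b ∷ 1 ∷ []) ⊆ w → falsesThenTrues (highMask w) ≡ false
high1⊆⇒¬falsesThenTrues {w = x ∷ w} 1<b (_ ∷ʳ s) rewrite highMask-∷ x w with 1 <ᵇ x
... | false = high1⊆⇒¬falsesThenTrues 1<b s
... | true  = ¬falsesThenTrues⇒¬and (highMask w) (high1⊆⇒¬falsesThenTrues 1<b s)
  where
  ¬falsesThenTrues⇒¬and : ∀ bs → falsesThenTrues bs ≡ false → and bs ≡ false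
  ¬falsesThenTrues⇒¬and (false ∷ bs) _ = refl
  ¬falsesThenTrues⇒¬and (true ∷ bs)  h = h
high1⊆⇒¬falsesThenTrues {w = x ∷ w} 1<b (refl ∷ s) rewrite highMask-∷ x w | <ᵇ-true 1<b = 1⊆⇒¬and s

¬falsesThenTrues⇒high1⊆ : ∀ {w} → Positive w → falsesThenTrues (highMask w) ≡ false → ∃[ b ] 1 < b × (b ∷ 1 ∷ []) ⊆ w
¬falsesThenTrues⇒high1⊆ {suc zero ∷ w} (_ ∷ pw) h with ¬falsesThenTrues⇒high1⊆ pw h
... | b , 1<b , s = b , 1<b , _ ∷ʳ s
¬falsesThenTrues⇒high1⊆ {suc (suc x) ∷ w} (_ ∷ pw) h = suc (suc x) , s≤s (s≤s z≤n) , refl ∷ ¬and⇒1⊆ pw h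

1high⊆⇒¬truesThenFalses : ∀ {b w} → 1 < b → (1 ∷ b ∷ []) ⊆ w → truesThenFalses (highMask w) ≡ false
1high⊆⇒¬truesThenFalses {w = x ∷ w} 1<b (_ ∷ʳ s) rewrite highMask-∷ x w with 1 <ᵇ x
... | true  = 1high⊆⇒¬truesThenFalses 1<b s
... | false = ¬truesThenFalses⇒¬allNot (highMask w) (1high⊆⇒¬truesThenFalses 1<b s)
  where
  ¬truesThenFalses⇒¬allNot : ∀ bs → truesThenFalses bs ≡ false → all not bs ≡ false
  ¬truesThenFalses⇒¬allNot (true ∷ bs)  _ = refl
  ¬truesThenFalses⇒¬allNot (false ∷ bs) h = h
1high⊆⇒¬truesThenFalses 1<b (refl ∷ s) = high⊆⇒¬allNot 1<b s

¬truesThenFalses⇒1high⊆ : ∀ {w} → Positive w → truesThenFalses (highMask w) ≡ false → ∃[ b ] 1 < b × (1 ∷ b ∷ []) ⊆ w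
¬truesThenFalses⇒1high⊆ {suc zero ∷ w} (_ ∷ pw) h with ¬allNot⇒high⊆ pw h
... | b , 1<b , s = b , 1<b , refl ∷ s
¬truesThenFalses⇒1high⊆ {suc (suc x) ∷ w} (_ ∷ pw) h with ¬truesThenFalses⇒1high⊆ pw h
... | b , 1<b , s = b , 1<b , _ ∷ʳ s

orderIso-11 : ∀ t → orderIso (1 ∷ 1 ∷ []) t ≡ true → ∃[ a ] t ≡ a ∷ a ∷ []
orderIso-11 t iso with orderIso-length (1 ∷ 1 ∷ []) t iso
orderIso-11 (a ∷ b ∷ []) iso | _ =
  a , cong (λ c → a ∷ c ∷ []) (sym (sameOrder-≡ {1} (∧-conicalˡ _ true (∧-conicalˡ _ true iso))))

orderIso-121 : ∀ t → orderIso (1 ∷ 2 ∷ 1 ∷ []) t ≡ true → ∃[ a ] ∃[ b ] a < b × t ≡ a ∷ b ∷ a ∷ []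
orderIso-121 t iso with orderIso-length (1 ∷ 2 ∷ 1 ∷ []) t iso
orderIso-121 (a ∷ b ∷ c ∷ []) iso | _ =
  a , b , sameOrder-< {1} {2} (∧-conicalˡ _ _ heads) (s≤s (s≤s z≤n))
  , cong (λ d → a ∷ b ∷ d ∷ []) (sym (sameOrder-≡ {1} (∧-conicalˡ _ true (∧-conicalʳ (sameOrder 1 2 a b) _ heads))))
  where
  heads : (sameOrder 1 2 a b ∧ (sameOrder 1 1 a c ∧ true)) ≡ true
  heads = ∧-conicalˡ _ _ iso

orderIso-112 : ∀ t → orderIso (1 ∷ 1 ∷ 2 ∷ []) t ≡ true → ∃[ a ] ∃[ b ] a < b × t ≡ a ∷ a ∷ b ∷ []
orderIso-112 t iso with orderIso-length (1 ∷ 1 ∷ 2 ∷ []) t iso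
orderIso-112 (a ∷ b ∷ c ∷ []) iso | _ =
  a , c , sameOrder-< {1} {2} (∧-conicalˡ _ true (∧-conicalʳ (sameOrder 1 1 a b) _ heads)) (s≤s (s≤s z≤n))
  , cong (λ d → a ∷ d ∷ c ∷ []) (sym (sameOrder-≡ {1} (∧-conicalˡ _ _ heads)))
  where
  heads : (sameOrder 1 1 a b ∧ (sameOrder 1 2 a c ∧ true)) ≡ true
  heads = ∧-conicalˡ _ _ iso

⊆1∷-head : ∀ {a t w} → Positive w → (a ∷ t) ⊆ (1 ∷ w) → a ≡ 1 ⊎ 1 < a
⊆1∷-head pw s with All-resp-⊆ s (s≤s z≤n ∷ pw)
... | _∷_ {x = suc zero}    _ _ = inj₁ refl
... | _∷_ {x = suc (suc a)} _ _ = inj₂ (s≤s (s≤s z≤n))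

removeOnes-contains-∷ : ∀ σ x w → contains σ (removeOnes w) ≡ true → contains σ (x ∷ w) ≡ true
removeOnes-contains-∷ σ x w σ∈w with removeOnes-contains⁻ σ w σ∈w
... | t , t⊆w , _ , iso = ⊆⇒contains σ (x ∷ʳ t⊆w) iso

avoids-11-∷ : ∀ w → Positive w →
  avoids (1 ∷ 1 ∷ []) (1 ∷ w) ≡ avoids (1 ∷ 1 ∷ []) (removeOnes w) ∧ and (highMask w)
avoids-11-∷ w pw = not≡not∧ split (removeOnes-contains-∷ σ 1 w) (λ ¬and → ⊆⇒contains σ (refl ∷ ¬and⇒1⊆ pw ¬and) refl)
  where
  σ : List ℕ
  σ = 1 ∷ 1 ∷ []
  split : contains σ (1 ∷ w) ≡ true → contains σ (removeOnes w) ≡ true ⊎ and (highMask w) ≡ false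
  split σ∈1w with contains⇒⊆ σ (1 ∷ w) σ∈1w
  ... | t , t⊆ , iso with orderIso-11 t iso
  ... | a , refl with ⊆1∷-head pw t⊆
  ... | inj₁ refl = inj₂ (1⊆⇒¬and (∷⁻ t⊆))
  ... | inj₂ 1<a  = inj₁ (removeOnes-contains⁺ σ t⊆ (1<a ∷ 1<a ∷ []) iso)

avoids-121-∷ : ∀ w → Positive w →
  avoids (1 ∷ 2 ∷ 1 ∷ []) (1 ∷ w) ≡ avoids (1 ∷ 2 ∷ 1 ∷ []) (removeOnes w) ∧ falsesThenTrues (highMask w)
avoids-121-∷ w pw = not≡not∧ split (removeOnes-contains-∷ σ 1 w) witness
  where
  σ : List ℕ
  σ = 1 ∷ 2 ∷ 1 ∷ []
  split : contains σ (1 ∷ w) ≡ true → contains σ (removeOnes w) ≡ true ⊎ falsesThenTrues (highMask w) ≡ false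
  split σ∈1w with contains⇒⊆ σ (1 ∷ w) σ∈1w
  ... | t , t⊆ , iso with orderIso-121 t iso
  ... | a , b , a<b , refl with ⊆1∷-head pw t⊆
  ... | inj₁ refl = inj₂ (high1⊆⇒¬falsesThenTrues a<b (∷⁻ t⊆))
  ... | inj₂ 1<a  = inj₁ (removeOnes-contains⁺ σ t⊆ (1<a ∷ <-trans 1<a a<b ∷ 1<a ∷ []) iso)
  witness : falsesThenTrues (highMask w) ≡ false → contains σ (1 ∷ w) ≡ true
  witness ¬ftt with ¬falsesThenTrues⇒high1⊆ pw ¬ftt
  ... | suc (suc b) , s≤s (s≤s z≤n) , s = ⊆⇒contains σ (refl ∷ s) refl

avoids-112-∷ : ∀ w → Positive w →
  avoids (1 ∷ 1 ∷ 2 ∷ []) (1 ∷ w) ≡ avoids (1 ∷ 1 ∷ 2 ∷ []) (removeOnes w) ∧ truesThenFalses (highMask w)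
avoids-112-∷ w pw = not≡not∧ split (removeOnes-contains-∷ σ 1 w) witness
  where
  σ : List ℕ
  σ = 1 ∷ 1 ∷ 2 ∷ []
  split : contains σ (1 ∷ w) ≡ true → contains σ (removeOnes w) ≡ true ⊎ truesThenFalses (highMask w) ≡ false
  split σ∈1w with contains⇒⊆ σ (1 ∷ w) σ∈1w
  ... | t , t⊆ , iso with orderIso-112 t iso
  ... | a , b , a<b , refl with ⊆1∷-head pw t⊆
  ... | inj₁ refl = inj₂ (1high⊆⇒¬truesThenFalses a<b (∷⁻ t⊆))
  ... | inj₂ 1<a  = inj₁ (removeOnes-contains⁺ σ t⊆ (1<a ∷ 1<a ∷ <-trans 1<a a<b ∷ []) iso)
  witness : truesThenFalses (highMask w) ≡ false → contains σ (1 ∷ w) ≡ true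
  witness ¬ttf with ¬truesThenFalses⇒1high⊆ pw ¬ttf
  ... | suc (suc b) , s≤s (s≤s z≤n) , s = ⊆⇒contains σ (refl ∷ s) refl

maskSum-and : ∀ n X → maskSum n and X ≡ X n
maskSum-and zero    X = refl
maskSum-and (suc n) X = cong₂ _+_ (maskSum-none n X) (maskSum-and n (X ∘ suc))

maskSum-allNot : ∀ n X → maskSum n (all not) X ≡ X 0
maskSum-allNot zero    X = refl
maskSum-allNot (suc n) X = trans (cong₂ _+_ (maskSum-allNot n X) (maskSum-none n (X ∘ suc))) (+-identityʳ (X 0))

maskSum-falsesThenTrues : ∀ n X → maskSum n falsesThenTrues X ≡ ∑< (suc n) X
maskSum-falsesThenTrues zero    X = sym (+-identityʳ (X 0))
maskSum-falsesThenTrues (suc n) X =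
  trans (cong₂ _+_ (maskSum-falsesThenTrues n X) (maskSum-and n (X ∘ suc))) (sym (∑<-snoc (suc n) X))

maskSum-truesThenFalses : ∀ n X → maskSum n truesThenFalses X ≡ ∑< (suc n) X
maskSum-truesThenFalses zero    X = sym (+-identityʳ (X 0))
maskSum-truesThenFalses (suc n) X = cong₂ _+_ (maskSum-allNot n X) (maskSum-truesThenFalses n (X ∘ suc))

prefix-sums-doubling : ∀ (q : ℕ → ℕ) → q 0 ≡ 1 → (∀ n → q (suc n) ≡ ∑< (suc n) q) → ∀ n → q (suc n) ≡ 2 ^ n
prefix-sums-doubling q q0 q-rec n = trans (q-rec n) (∑<-q n)
  where
  ∑<-q : ∀ n → ∑< (suc n) q ≡ 2 ^ n
  ∑<-q zero    = trans (+-identityʳ (q 0)) q0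
  ∑<-q (suc n) = begin
    ∑< (suc (suc n)) q        ≡⟨ ∑<-snoc (suc n) q ⟩
    ∑< (suc n) q + q (suc n)  ≡⟨ cong₂ _+_ (∑<-q n) (trans (q-rec n) (∑<-q n)) ⟩
    2 ^ n + 2 ^ n             ≡⟨ cong (2 ^ n +_) (sym (+-identityʳ (2 ^ n))) ⟩
    2 ^ suc n                 ∎
    where open ≡-Reasoning

binomial-δ : ∀ n {X} → X 0 ≡ 1 → (∀ j → X (suc j) ≡ 0) → binomial n X ≡ 1
binomial-δ zero    X0 _   = X0
binomial-δ (suc n) X0 X+0 = cong₂ _+_ (binomial-δ n X0 X+0) (trans (binomial-const n 0 X+0) (*-zeroʳ (2 ^ n)))

PowersOfTwo : List ℕ → Set
PowersOfTwo σ = p 0 σ ≡ 1 × (∀ n → p (suc n) σ ≡ 2 ^ n)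

PowersOfTwo-∼ : ∀ σ σ' → PowersOfTwo σ → PowersOfTwo σ' → σ ∼ σ'
PowersOfTwo-∼ _ _ (p0 , _)  (p0' , _)  zero    = trans p0 (sym p0')
PowersOfTwo-∼ _ _ (_ , pσ)  (_ , pσ')  (suc n) = trans (pσ n) (sym (pσ' n))

p-[] : ∀ n → p n [] ≡ 0
p-[] n = trans (length-filter (avoids []) (partitionsOf n))
               (countᵇ-false (partitionsOf n) (λ w → cong not (⊆⇒contains [] (minimum w) refl)))

p-1 : ∀ n → p (suc n) (1 ∷ []) ≡ 0
p-1 n = trans (p-suc-lift n [] []) (trans (binomial-const n 0 p-[]) (*-zeroʳ (2 ^ n)))

p-12 : ∀ n → p n (1 ∷ 2 ∷ []) ≡ 1
p-12 zero    = refl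
p-12 (suc n) = trans (p-suc-lift n (1 ∷ []) (s≤s z≤n ∷ [])) (binomial-δ n refl p-1)

p-11 : ∀ n → p n (1 ∷ 1 ∷ []) ≡ 1
p-11 zero    = refl
p-11 (suc n) = trans (p-suc n (1 ∷ 1 ∷ []) (1 ∷ 1 ∷ []) and avoids-11-∷) (trans (maskSum-and n _) (p-11 n))

powersOfTwo-123 : PowersOfTwo (1 ∷ 2 ∷ 3 ∷ [])
powersOfTwo-123 = refl , λ n →
  trans (p-suc-lift n (1 ∷ 2 ∷ []) (s≤s z≤n ∷ s≤s z≤n ∷ [])) (trans (binomial-const n 1 p-12) (*-identityʳ (2 ^ n)))

powersOfTwo-122 : PowersOfTwo (1 ∷ 2 ∷ 2 ∷ [])
powersOfTwo-122 = refl , λ n →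
  trans (p-suc-lift n (1 ∷ 1 ∷ []) (s≤s z≤n ∷ s≤s z≤n ∷ [])) (trans (binomial-const n 1 p-11) (*-identityʳ (2 ^ n)))

powersOfTwo-121 : PowersOfTwo (1 ∷ 2 ∷ 1 ∷ [])
powersOfTwo-121 = refl , prefix-sums-doubling (λ j → p j σ) refl λ n →
  trans (p-suc n σ σ falsesThenTrues avoids-121-∷) (maskSum-falsesThenTrues n _)
  where
  σ : List ℕ
  σ = 1 ∷ 2 ∷ 1 ∷ []

powersOfTwo-112 : PowersOfTwo (1 ∷ 1 ∷ 2 ∷ [])
powersOfTwo-112 = refl , prefix-sums-doubling (λ j → p j σ) refl λ n →
  trans (p-suc n σ σ truesThenFalses avoids-112-∷) (maskSum-truesThenFalses n _)
  where
  σ : List ℕ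
  σ = 1 ∷ 1 ∷ 2 ∷ []

-- Increasing prefixes

+ˢ-+ˢ : ∀ τ k l → (τ +ˢ k) +ˢ l ≡ τ +ˢ (k + l)
+ˢ-+ˢ τ k l = trans (sym (map-∘ τ)) (map-cong (λ x → +-assoc x k l) τ)

+ˢ-0 : ∀ τ → τ +ˢ 0 ≡ τ
+ˢ-0 τ = trans (map-cong +-identityʳ τ) (map-id τ)

inc-snoc : ∀ n → inc (suc n) ≡ inc n ++ (suc n ∷ [])
inc-snoc n = trans (cong (map suc) (sym (applyUpTo-∷ʳ id n))) (map-++ suc (upTo n) (n ∷ []))

inc-+ : ∀ j k → inc (j + k) ≡ inc k ++ (inc j +ˢ k)
inc-+ zero    k = sym (++-identityʳ (inc k))
inc-+ (suc j) k = begin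
  inc (suc (j + k))                                   ≡⟨ inc-snoc (j + k) ⟩
  inc (j + k) ++ (suc j + k ∷ [])                     ≡⟨ cong (_++ (suc j + k ∷ [])) (inc-+ j k) ⟩
  (inc k ++ (inc j +ˢ k)) ++ (suc j + k ∷ [])         ≡⟨ ++-assoc (inc k) (inc j +ˢ k) _ ⟩
  inc k ++ ((inc j +ˢ k) ++ ((suc j ∷ []) +ˢ k))      ≡⟨ cong (inc k ++_) (map-++ (_+ k) (inc j) (suc j ∷ [])) ⟨
  inc k ++ ((inc j ++ (suc j ∷ [])) +ˢ k)             ≡⟨ cong (λ ρ → inc k ++ (ρ +ˢ k)) (inc-snoc j) ⟨
  inc k ++ (inc (suc j) +ˢ k)                         ∎
  where open ≡-Reasoning

inc-+-++ : ∀ j k ρ → inc (j + k) ++ (ρ +ˢ k) ≡ inc k ++ ((inc j ++ ρ) +ˢ k)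
inc-+-++ j k ρ = begin
  inc (j + k) ++ (ρ +ˢ k)                ≡⟨ cong (_++ (ρ +ˢ k)) (inc-+ j k) ⟩
  (inc k ++ (inc j +ˢ k)) ++ (ρ +ˢ k)    ≡⟨ ++-assoc (inc k) _ _ ⟩
  inc k ++ ((inc j +ˢ k) ++ (ρ +ˢ k))    ≡⟨ cong (inc k ++_) (map-++ (_+ k) (inc j) ρ) ⟨
  inc k ++ ((inc j ++ ρ) +ˢ k)           ∎
  where open ≡-Reasoning

inc-suc-++ : ∀ k τ → inc (suc k) ++ (τ +ˢ suc k) ≡ 1 ∷ ((inc k ++ (τ +ˢ k)) +ˢ 1)
inc-suc-++ k τ = begin
  inc (suc k) ++ (τ +ˢ suc k)       ≡⟨ cong (λ n → inc n ++ (τ +ˢ n)) (+-comm 1 k) ⟩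
  inc (k + 1) ++ (τ +ˢ (k + 1))     ≡⟨ cong (inc (k + 1) ++_) (+ˢ-+ˢ τ k 1) ⟨
  inc (k + 1) ++ ((τ +ˢ k) +ˢ 1)    ≡⟨ inc-+-++ k 1 (τ +ˢ k) ⟩
  1 ∷ ((inc k ++ (τ +ˢ k)) +ˢ 1)    ∎
  where open ≡-Reasoning

inc-++-positive : ∀ k {τ} → Positive τ → Positive (inc k ++ (τ +ˢ k))
inc-++-positive k pτ =
  All.++⁺ (All.map⁺ (All.universal (λ _ → s≤s z≤n) (upTo k))) (All.map⁺ (All.map (λ {x} 1≤x → ≤-trans 1≤x (m≤m+n x k)) pτ))

lift-∼ : ∀ τ τ' → Positive τ → Positive τ' → τ ∼ τ' → (1 ∷ (τ +ˢ 1)) ∼ (1 ∷ (τ' +ˢ 1))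
lift-∼ τ τ' pτ pτ' τ∼τ' zero    = refl
lift-∼ τ τ' pτ pτ' τ∼τ' (suc n) = begin
  p (suc n) (1 ∷ (τ +ˢ 1))      ≡⟨ p-suc-lift n τ pτ ⟩
  binomial n (λ j → p j τ)      ≡⟨ maskSum-cong n _ τ∼τ' ⟩
  binomial n (λ j → p j τ')     ≡⟨ p-suc-lift n τ' pτ' ⟨
  p (suc n) (1 ∷ (τ' +ˢ 1))     ∎
  where open ≡-Reasoning

lift-∼⁻ : ∀ τ τ' → Positive τ → Positive τ' → (1 ∷ (τ +ˢ 1)) ∼ (1 ∷ (τ' +ˢ 1)) → τ ∼ τ'
lift-∼⁻ τ τ' pτ pτ' lifted∼ = binomial-injective λ n →
  trans (sym (p-suc-lift n τ pτ)) (trans (lifted∼ (suc n)) (p-suc-lift n τ' pτ'))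

inc-lift-∼ : ∀ k τ τ' → Positive τ → Positive τ' → τ ∼ τ' → (inc k ++ (τ +ˢ k)) ∼ (inc k ++ (τ' +ˢ k))
inc-lift-∼ zero    τ τ' _  _   τ∼τ' = subst₂ _∼_ (sym (+ˢ-0 τ)) (sym (+ˢ-0 τ')) τ∼τ'
inc-lift-∼ (suc k) τ τ' pτ pτ' τ∼τ' rewrite inc-suc-++ k τ | inc-suc-++ k τ' =
  lift-∼ _ _ (inc-++-positive k pτ) (inc-++-positive k pτ') (inc-lift-∼ k τ τ' pτ pτ' τ∼τ')

increasing-patterns-∼ : ∀ m → 2 ≤ m →
    (inc (m + 1) ∼ (inc m ++ (m ∷ [])))
  × (inc (m + 1) ∼ (inc (m ∸ 1) ++ ((m ∸ 1) ∷ m ∷ [])))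
  × (inc (m + 1) ∼ (inc m ++ ((m ∸ 1) ∷ [])))
increasing-patterns-∼ (suc (suc k)) (s≤s (s≤s z≤n)) =
    shifted (1 ∷ 2 ∷ 2 ∷ []) (inc-+-++ 2 k (2 ∷ [])) (1≤ ∷ 1≤ ∷ 1≤ ∷ []) powersOfTwo-122
  , shifted (1 ∷ 1 ∷ 2 ∷ []) (inc-+-++ 1 k (1 ∷ 2 ∷ [])) (1≤ ∷ 1≤ ∷ 1≤ ∷ []) powersOfTwo-112
  , shifted (1 ∷ 2 ∷ 1 ∷ []) (inc-+-++ 2 k (1 ∷ [])) (1≤ ∷ 1≤ ∷ 1≤ ∷ []) powersOfTwo-121
  where
  1≤ : ∀ {n} → 1 ≤ suc n
  1≤ = s≤s z≤n
  shifted : ∀ ρ {σ} → σ ≡ inc k ++ (ρ +ˢ k) → Positive ρ → PowersOfTwo ρ → inc (suc (suc k) + 1) ∼ σ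
  shifted ρ σ≡ pρ ρ-powers = subst₂ _∼_
    (sym (trans (cong inc (+-comm (suc (suc k)) 1)) (inc-+ 3 k)))
    (sym σ≡)
    (inc-lift-∼ k (1 ∷ 2 ∷ 3 ∷ []) ρ (1≤ ∷ 1≤ ∷ 1≤ ∷ []) pρ (PowersOfTwo-∼ (1 ∷ 2 ∷ 3 ∷ []) ρ powersOfTwo-123 ρ-powers))

mainTheorem3 :
    (∀ (τ τ' : _) → IsPartition τ → IsPartition τ' → τ ∼ τ' →
        (1 ∷ (τ +ˢ 1)) ∼ (1 ∷ (τ' +ˢ 1))
      × (∀ (k : ℕ) → 1 ≤ k → (inc k ++ (τ +ˢ k)) ∼ (inc k ++ (τ' +ˢ k))))
    × (∀ (m : ℕ) → 2 ≤ m →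
        (inc (m + 1) ∼ (inc m ++ (m ∷ [])))
      × (inc (m + 1) ∼ (inc (m ∸ 1) ++ ((m ∸ 1) ∷ m ∷ [])))
      × (inc (m + 1) ∼ (inc m ++ ((m ∸ 1) ∷ []))))
    × (∀ (τ τ' : _) → IsPartition τ → IsPartition τ' →
        (1 ∷ (τ +ˢ 1)) ∼ (1 ∷ (τ' +ˢ 1)) → τ ∼ τ')
mainTheorem3 =
    (λ τ τ' τ-part τ'-part τ∼τ' →
         lift-∼ τ τ' (partition-positive τ-part) (partition-positive τ'-part) τ∼τ'
       , λ k _ → inc-lift-∼ k τ τ' (partition-positive τ-part) (partition-positive τ'-part) τ∼τ')  -- also for k = 0
  , increasing-patterns-∼
  , (λ τ τ' τ-part τ'-part → lift-∼⁻ τ τ' (partition-positive τ-part) (partition-positive τ'-part))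
  where
  partition-positive : ∀ {τ} → IsPartition τ → Positive τ
  partition-positive = rgsFrom-positive 0 _
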